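{- Let $(U,\mathrm{dist})$ be a metric space, let $S\subseteq U$ be a finite set of points, and let $T$ be a cover tree for $S$ with root $r$ at level $\ell_{\max}$. For every point $p\in U$, every integer $\ell\le \ell_{\max}$, and every node $u\in T_\ell\setminus Q^p_\ell$, we have $\mathrm{dist}(p,u)>2^{\ell+1}$.
   Context: A cover tree $T$ for a finite set $S\subseteq U$ is a rooted tree whose levels are indexed by integers decreasing from the root towards the leaves. $T_\ell$ denotes the set of nodes at level $\ell$; each node $u$ is associated with a point $u.\mathrm{point}\in S$, and the points $\mathrm{pts}(T_\ell)$ associated with the nodes of $T_\ell$ are distinct. Every non-root node $u\in T_\ell$ has a parent $u.\mathrm{parent}\in T_{\ell+1}$. For nodes $u,v$ and a point $p$ write $\mathrm{dist}(u,v)=\mathrm{dist}(u.\mathrm{point},v.\mathrm{point})$ and $\mathrm{dist}(p,u)=\mathrm{dist}(p,u.\mathrm{point})$. For every level $\ell$: (1) $\mathrm{pts}(T_\ell)\subseteq \mathrm{pts}(T_{\ell-1})$; (2) for each $u\in T_\ell$, $\mathrm{dist}(u,u.\mathrm{parent})\le 2^{\ell+1}$; (3) for all distinct $u,v\in T_\ell$, $\mathrm{dist}(u,v)>2^\ell$. $\ell_{\max}$ is the smallest index with $|T_{\ell}|=1$, and the unique node $r\in T_{\ell_{\max}}$ is regarded as the root. For $p\in U$, the cover sets $Q^p_\ell\subseteq T_\ell$ are defined inductively by $Q^p_{\ell_{\max}}=\{r\}$ and, for $\ell<\ell_{\max}$, $Q^p_\ell=\{u\in T_\ell : u.\mathrm{parent}\in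 Q^p_{\ell+1} \text{ and } \mathrm{dist}(u,p)\le 2^{\ell+1}\}$. -}

module Defs where

open import Data.Nat using (ℕ; zero; suc)
open import Data.Integer as ℤ using (ℤ; +_; -[1+_])
open import Data.Product using (Σ; ∃; _×_; _,_)
open import Data.List using (List)
open import Data.List.Membership.Propositional using (_∈_)
open import Relation.Nullary using (¬_)
open import Relation.Binary.PropositionalEquality using (_≡_)
open import Relation.Binary.Structures using (IsTotalOrder)
open import Algebra.Structures using (IsCommutativeRing)

-- An ordered field (the value domain of the metric; the reals are the
-- intended instance, but agda-stdlib has no reals).
record OrderedField : Set₁ where
  infixl 6 _+_
  infixl 7 _*_
  infix 4 _≤_ _<_
  field
    F      : Set
    _+_    : F → F → F
    _*_    : F → F → F
    -_     : F → F
    0#     : F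
    1#     : F
    _⁻¹    : F → F
    _≤_    : F → F → Set
    isCommutativeRing : IsCommutativeRing _≡_ _+_ _*_ -_ 0# 1#
    0≢1     : ¬ (0# ≡ 1#)
    inverse : ∀ x → ¬ (x ≡ 0#) → x * (x ⁻¹) ≡ 1#
    isTotalOrder : IsTotalOrder _≡_ _≤_
    +-mono-≤ : ∀ {a b} c → a ≤ b → a + c ≤ b + c
    *-nonneg : ∀ {a b} → 0# ≤ a → 0# ≤ b → 0# ≤ a * b

  _<_ : F → F → Set
  a < b = a ≤ b × ¬ (a ≡ b)

  two : F
  two = 1# + 1#

  half : F
  half = two ⁻¹

  _^ℕ_ : F → ℕ → F
  x ^ℕ zero = 1#
  x ^ℕ suc n = x * (x ^ℕ n)

  pow2 : ℤ → F
  pow2 (+ n)    = two ^ℕ n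
  pow2 -[1+ n ] = half ^ℕ suc n

record MetricSpace (K : OrderedField) : Set₁ where
  open OrderedField K
  field
    U        : Set
    dist     : U → U → F
    dist-nonneg : ∀ x y → 0# ≤ dist x y
    dist-zero   : ∀ x y → dist x y ≡ 0# → x ≡ y
    dist-self   : ∀ x → dist x x ≡ 0#
    dist-sym    : ∀ x y → dist x y ≡ dist y x
    dist-tri    : ∀ x y z → dist x z ≤ dist x y + dist y z

-- A cover tree for the finite set S (given as a list) of points of U.
-- Nodes form a type Node; T_ℓ = { u | level u ≡ ℓ }.
record CoverTree (K : OrderedField) (M : MetricSpace K) (S : List (MetricSpace.U M)) : Set₁ where
  open OrderedField K
  open MetricSpace M
  field
    Node   : Set
    level  : Node → ℤ
    point  : Node → U
    parent : Node → Node
    ℓmax   : ℤ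
    root   : Node
    point∈S   : ∀ u → point u ∈ S
    covers-S  : ∀ s → s ∈ S → ∃ λ u → point u ≡ s
    root-level : level root ≡ ℓmax
    level≤ℓmax : ∀ u → level u ℤ.≤ ℓmax
    root-unique : ∀ u → level u ≡ ℓmax → u ≡ root
    -- ℓmax is the smallest index with |T_ℓ| = 1
    ℓmax-minimal : ∀ ℓ → ℓ ℤ.< ℓmax →
      ¬ (∃ λ u → level u ≡ ℓ × (∀ v → level v ≡ ℓ → v ≡ u))
    parent-level : ∀ u → level u ℤ.< ℓmax → level (parent u) ≡ level u ℤ.+ + 1
    points-distinct : ∀ u v → level u ≡ level v → point u ≡ point v → u ≡ v
    nesting : ∀ u → ∃ λ v → level v ≡ level u ℤ.- + 1 × point v ≡ point u
    covering : ∀ u → level u ℤ.< ℓmax →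
      dist (point u) (point (parent u)) ≤ pow2 (level u ℤ.+ + 1)
    separation : ∀ u v → level u ≡ level v → ¬ (u ≡ v) →
      pow2 (level u) < dist (point u) (point v)

-- The cover sets Q^p_ℓ, as a predicate on nodes (u ∈ Q^p_{level u}).
module _ {K : OrderedField} {M : MetricSpace K} {S : List (MetricSpace.U M)}
         (T : CoverTree K M S) where
  open OrderedField K
  open MetricSpace M
  open CoverTree T

  data InQ (p : U) : Node → Set where
    Q-root : InQ p root
    Q-step : ∀ u → level u ℤ.< ℓmax → InQ p (parent u) →
             dist p (point u) ≤ pow2 (level u ℤ.+ + 1) → InQ p u

{-# OPTIONS --safe #-}
-- Go up from u towards the root.  A node at the top level is the root, which
-- lies in Q.  For a node u below it, if p were within 2^(ℓ+1) of u then its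
-- parent could not lie in Q either (else u would); by induction p is then
-- more than 2^(ℓ+2) from the parent, while the parent is within 2^(ℓ+1) of u,
-- so by the triangle inequality p is more than 2^(ℓ+1) from u after all.
module Submission where

open import Defs
open import Algebra.Bundles using (CommutativeRing)
import Algebra.Properties.Ring as RingProperties
open import Data.Integer as ℤ using (ℤ; +_; -[1+_])
import Data.Integer.Properties as ℤ
open import Data.Integer.Tactic.RingSolver using (solve-∀)
open import Data.Nat using (ℕ; zero; suc; z<s)
import Data.Nat.Properties as ℕ
open import Data.List using (List)
open import Function using (_∘_)
open import Data.Product using (∃; _,_; proj₂)
open import Data.Sum using (inj₁; inj₂)
open import Relation.Nullary using (¬_; contradiction)
open import Relation.Binary.PropositionalEquality
open import Relation.Binary.Structures using (IsTotalOrder)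

≤⇒∃-gap : ∀ {i j} → i ℤ.≤ j → ∃ λ k → i ℤ.+ + k ≡ j
≤⇒∃-gap {i} {j} i≤j = ℤ.∣ i ℤ.- j ∣ , (begin
  i ℤ.+ + ℤ.∣ i ℤ.- j ∣  ≡⟨ cong (λ n → i ℤ.+ n) (ℤ.∣-∣-≤ i≤j) ⟩
  i ℤ.+ (j ℤ.- i)        ≡⟨ i+[j-i]≡j i j ⟩
  j                      ∎)
  where
  open ≡-Reasoning
  i+[j-i]≡j : ∀ i j → i ℤ.+ (j ℤ.- i) ≡ j
  i+[j-i]≡j = solve-∀

i<i+suc : ∀ i k → i ℤ.< i ℤ.+ + suc k
i<i+suc i k = subst (ℤ._< i ℤ.+ + suc k) (ℤ.+-identityʳ i) (ℤ.+-monoʳ-< i (ℤ.+<+ z<s))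

module OrderedFieldProperties (K : OrderedField) where
  open OrderedField K
  open IsTotalOrder isTotalOrder public using (total; antisym) renaming (trans to ≤-trans)

  commutativeRing : CommutativeRing _ _
  commutativeRing = record { isCommutativeRing = isCommutativeRing }

  open CommutativeRing commutativeRing
    using (ring; +-congˡ; +-assoc; +-comm; +-identityˡ; +-identityʳ; -‿inverseʳ; distribʳ; *-assoc; *-identityˡ; *-identityʳ)
  open RingProperties ring using (-1*x≈-x; -‿involutive)
  open ≡-Reasoning

  +-cancelʳ-≤ : ∀ {a b} c → a + c ≤ b + c → a ≤ b
  +-cancelʳ-≤ {a} {b} c = subst₂ _≤_ (x+c-c≡x a) (x+c-c≡x b) ∘ +-mono-≤ (- c)
    where
    x+c-c≡x : ∀ x → x + c + - c ≡ x
    x+c-c≡x x = trans (+-assoc x c (- c)) (trans (+-congˡ (-‿inverseʳ c)) (+-identityʳ x))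

  +-monoʳ-≤ : ∀ c {a b} → a ≤ b → c + a ≤ c + b
  +-monoʳ-≤ c {a} {b} = subst₂ _≤_ (+-comm a c) (+-comm b c) ∘ +-mono-≤ c

  +-cancelʳ-< : ∀ {a b} c → a + c < b + c → a < b
  +-cancelʳ-< c (a+c≤b+c , a+c≢b+c) = +-cancelʳ-≤ c a+c≤b+c , λ a≡b → a+c≢b+c (cong (_+ c) a≡b)

  <-≤-trans : ∀ {a b c} → a < b → b ≤ c → a < c
  <-≤-trans (a≤b , a≢b) b≤c = ≤-trans a≤b b≤c , λ { refl → a≢b (antisym a≤b b≤c) }

  <-by-refuting-≤ : ∀ {a b} → (b ≤ a → a < b) → a < b
  <-by-refuting-≤ {a} {b} b≤a⇒a<b with total a b
  ... | inj₂ b≤a = b≤a⇒a<b b≤a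
  ... | inj₁ a≤b = a≤b , λ { refl → proj₂ (b≤a⇒a<b a≤b) refl }

  -1*-1≡1 : - 1# * - 1# ≡ 1#
  -1*-1≡1 = trans (-1*x≈-x (- 1#)) (-‿involutive 1#)

  0≤1 : 0# ≤ 1#
  0≤1 with total 0# 1#
  ... | inj₁ 0≤1′ = 0≤1′
  ... | inj₂ 1≤0 = contradiction (antisym 0≤[-1]*[-1] 1≤0) 0≢1
    where
    0≤-1 : 0# ≤ - 1#
    0≤-1 = subst₂ _≤_ (-‿inverseʳ 1#) (+-identityˡ (- 1#)) (+-mono-≤ (- 1#) 1≤0)
    0≤[-1]*[-1] : 0# ≤ 1#
    0≤[-1]*[-1] = subst (0# ≤_) -1*-1≡1 (*-nonneg 0≤-1 0≤-1)

  two≢0 : ¬ (two ≡ 0#)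
  two≢0 two≡0 = 0≢1 (antisym 0≤1 1≤0)
    where
    1≤0 : 1# ≤ 0#
    1≤0 = subst₂ _≤_ (+-identityˡ 1#) two≡0 (+-mono-≤ 1# 0≤1)

  two*[half*x]≡x : ∀ x → two * (half * x) ≡ x
  two*[half*x]≡x x = begin
    two * (half * x)  ≡⟨ *-assoc two half x ⟨
    two * half * x    ≡⟨ cong (_* x) (inverse two two≢0) ⟩
    1# * x            ≡⟨ *-identityˡ x ⟩
    x                 ∎

  pow2-suc : ∀ z → pow2 (z ℤ.+ + 1) ≡ two * pow2 z
  pow2-suc (+ n) rewrite ℕ.+-comm n 1 = refl
  pow2-suc -[1+ zero ]  = sym (two*[half*x]≡x 1#)
  pow2-suc -[1+ suc n ] = sym (two*[half*x]≡x (half ^ℕ suc n))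

  pow2-suc≡pow2+pow2 : ∀ z → pow2 (z ℤ.+ + 1) ≡ pow2 z + pow2 z
  pow2-suc≡pow2+pow2 z = begin
    pow2 (z ℤ.+ + 1)           ≡⟨ pow2-suc z ⟩
    (1# + 1#) * pow2 z         ≡⟨ distribʳ (pow2 z) 1# 1# ⟩
    1# * pow2 z + 1# * pow2 z  ≡⟨ cong₂ _+_ (*-identityˡ (pow2 z)) (*-identityˡ (pow2 z)) ⟩
    pow2 z + pow2 z            ∎

module CoverSetProperties {K : OrderedField} {M : MetricSpace K} {S : List (MetricSpace.U M)}
                          (T : CoverTree K M S) (p : MetricSpace.U M) where
  open OrderedField K
  open MetricSpace M
  open CoverTree T
  open OrderedFieldProperties K

  top-level⇒InQ : ∀ u → level u ≡ ℓmax → InQ T p u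
  top-level⇒InQ u level≡ℓmax rewrite root-unique u level≡ℓmax = Q-root

  far-parent⇒far : ∀ u → level u ℤ.< ℓmax →
    pow2 (level (parent u) ℤ.+ + 1) < dist p (point (parent u)) →
    pow2 (level u ℤ.+ + 1) < dist p (point u)
  far-parent⇒far u u<top parent-far = +-cancelʳ-< r (<-≤-trans 2r<d[p,parent] d[p,parent]≤d[p,u]+r)
    where
    r = pow2 (level u ℤ.+ + 1)
    2r<d[p,parent] : r + r < dist p (point (parent u))
    2r<d[p,parent] = subst (_< dist p (point (parent u)))
      (trans (cong (λ ℓ → pow2 (ℓ ℤ.+ + 1)) (parent-level u u<top)) (pow2-suc≡pow2+pow2 (level u ℤ.+ + 1)))
      parent-far
    d[p,parent]≤d[p,u]+r : dist p (point (parent u)) ≤ dist p (point u) + r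
    d[p,parent]≤d[p,u]+r = ≤-trans (dist-tri p (point u) (point (parent u)))
                                   (+-monoʳ-≤ (dist p (point u)) (covering u u<top))

  -- Membership in Q is not decidable, so rather than splitting on whether the
  -- parent lies in Q we refute the case in which p is near u.
  ∉Q⇒far : ∀ k u → level u ℤ.+ + k ≡ ℓmax → ¬ InQ T p u →
    pow2 (level u ℤ.+ + 1) < dist p (point u)
  ∉Q⇒far zero    u u+0≡top u∉Q =
    contradiction (top-level⇒InQ u (trans (sym (ℤ.+-identityʳ (level u))) u+0≡top)) u∉Q
  ∉Q⇒far (suc k) u u+k+1≡top u∉Q = <-by-refuting-≤ λ near →
    far-parent⇒far u u<top (∉Q⇒far k (parent u) parent+k≡top (parent∉Q near))
    where
    u<top : level u ℤ.< ℓmax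
    u<top = subst (level u ℤ.<_) u+k+1≡top (i<i+suc (level u) k)
    parent+k≡top : level (parent u) ℤ.+ + k ≡ ℓmax
    parent+k≡top = begin
      level (parent u) ℤ.+ + k   ≡⟨ cong (ℤ._+ + k) (parent-level u u<top) ⟩
      level u ℤ.+ + 1 ℤ.+ + k    ≡⟨ ℤ.+-assoc (level u) (+ 1) (+ k) ⟩
      level u ℤ.+ + suc k        ≡⟨ u+k+1≡top ⟩
      ℓmax                       ∎
      where open ≡-Reasoning
    parent∉Q : dist p (point u) ≤ pow2 (level u ℤ.+ + 1) → ¬ InQ T p (parent u)
    parent∉Q near parent∈Q = u∉Q (Q-step u u<top parent∈Q near)

lemma1 : (K : OrderedField) (M : MetricSpace K) (S : List (MetricSpace.U M))
    (T : CoverTree K M S) (p : MetricSpace.U M) (ℓ : ℤ) → ℓ ℤ.≤ CoverTree.ℓmax T →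
    (u : CoverTree.Node T) → CoverTree.level T u ≡ ℓ → ¬ InQ T p u →
    OrderedField._<_ K (OrderedField.pow2 K (ℓ ℤ.+ + 1))
      (MetricSpace.dist M p (CoverTree.point T u))
lemma1 K M S T p ℓ ℓ≤top u refl u∉Q =
  let k , ℓ+k≡top = ≤⇒∃-gap ℓ≤top in CoverSetProperties.∉Q⇒far T p k u ℓ+k≡top u∉Q
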